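{- Let $G$ be a graph and $k$ an integer with $k>\chi(G)+1$. Then every $k$-colouring $c$ of $G$ that uses at most $k-2$ colours satisfies $G_c\cong G$.
   Context: A (proper) $k$-colouring of $G$ is a map $V(G)\to[k]$ giving adjacent vertices different colours. A Kempe swap, for colours $i\neq j$, exchanges $i$ and $j$ on one connected component of the subgraph induced by the vertices coloured $i$ or $j$. $\mathcal{K}_k(G)$ is the graph on the $k$-colourings of $G$, two adjacent iff they differ by one Kempe swap. For a $k$-colouring $d$ and vertex $w$, $C_{d,w}$ is the set of $k$-colourings differing from $d$ exactly at $w$ (a clique of $\mathcal{K}_k(G)$). Condition $(\star\star\star)$ for $c_u\in C_{c,u}$, $c_v\in C_{c,v}$: $c_u$ and $c_v$ have a common neighbour $x\neq c$ in $\mathcal{K}_k(G)$, and there exist colourings $c_u',c_v'$ such that $\{x,c_u,c_u'\}$ and $\{x,c_v,c_v'\}$ both induce triangles in $\mathcal{K}_k(G)$. The candidate graph $G_c$ has vertex set $\{u\in V(G): |C_{c,u}|\geq 2\}$, and $u,v$ are adjacent in $G_c$ iff there exist $c_u\in C_{c,u}$ and $c_v\in C_{c,v}$ that do not satisfy $(\star\star\star)$. -}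

module Defs where

open import Data.Nat using (ℕ; _+_; _∸_; _<_; _≤_)
open import Data.Fin using (Fin)
open import Data.Fin.Subset using (Subset; _∈_; ∣_∣)
open import Data.Product using (Σ; ∃; _×_; _,_)
open import Data.Sum using (_⊎_)
open import Relation.Nullary using (¬_; Dec)
open import Relation.Binary.PropositionalEquality using (_≡_)
open import Function.Bundles using (_⇔_)

record Graph : Set₁ where
  field
    n      : ℕ
    Adj    : Fin n → Fin n → Set
    adj?   : ∀ u v → Dec (Adj u v)
    sym    : ∀ {u v} → Adj u v → Adj v u
    irrefl : ∀ {u} → ¬ Adj u u

module _ (G : Graph) where
  open Graph G

  Col : ℕ → Set
  Col k = Fin n → Fin k

  Proper : {k : ℕ} → Col k → Set
  Proper c = ∀ u v → Adj u v → ¬ c u ≡ c v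

  Colourable : ℕ → Set
  Colourable m = Σ (Col m) Proper

  IsChromaticNumber : ℕ → Set
  IsChromaticNumber χ = Colourable χ × (∀ m → m < χ → ¬ Colourable m)

  _≗c_ : {k : ℕ} → Col k → Col k → Set
  c ≗c d = ∀ w → c w ≡ d w

  UsesAtMost : {k : ℕ} → Col k → ℕ → Set
  UsesAtMost {k} c m = Σ (Subset k) λ S → (∣ S ∣ ≤ m) × (∀ v → c v ∈ S)

  InIJ : {k : ℕ} → Col k → Fin k → Fin k → Fin n → Set
  InIJ c i j w = (c w ≡ i) ⊎ (c w ≡ j)

  -- w and v lie in the same connected component of the subgraph induced by
  -- the vertices coloured i or j (both endpoints must be coloured i or j).
  data Linked {k : ℕ} (c : Col k) (i j : Fin k) : Fin n → Fin n → Set where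
    here : ∀ {v} → InIJ c i j v → Linked c i j v v
    step : ∀ {v w x} → Linked c i j v w → Adj w x → InIJ c i j x → Linked c i j v x

  data Swapped {k : ℕ} (i j : Fin k) : Fin k → Fin k → Set where
    i↦j : Swapped i j i j
    j↦i : Swapped i j j i

  -- d is obtained from c by one Kempe swap: for colours i ≠ j, exchange i and j
  -- on the component of the {i,j}-coloured subgraph containing vertex v.
  KempeAdj : {k : ℕ} → Col k → Col k → Set
  KempeAdj {k} c d =
    Σ (Fin k) λ i → Σ (Fin k) λ j → Σ (Fin n) λ v →
      (¬ i ≡ j) × InIJ c i j v ×
      (∀ w → (Linked c i j v w → Swapped i j (c w) (d w))
           × (¬ Linked c i j v w → d w ≡ c w))

  -- Adjacency in the Kempe graph 𝒦_k(G) (vertices: proper k-colourings).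
  KAdj : {k : ℕ} → Col k → Col k → Set
  KAdj c d = Proper c × Proper d × KempeAdj c d

  -- d ∈ C_{c,w}: a proper k-colouring differing from c exactly at w.
  InC : {k : ℕ} → Col k → Fin n → Col k → Set
  InC c w d = Proper d × (¬ d w ≡ c w) × (∀ x → ¬ x ≡ w → d x ≡ c x)

  -- |C_{c,w}| ≥ 2.
  CBig : {k : ℕ} → Col k → Fin n → Set
  CBig c w = Σ (Col _) λ d₁ → Σ (Col _) λ d₂ →
    InC c w d₁ × InC c w d₂ × ¬ (d₁ ≗c d₂)

  Triangle : {k : ℕ} → Col k → Col k → Col k → Set
  Triangle x a b = KAdj x a × KAdj a b × KAdj x b

  Star3 : {k : ℕ} → Col k → Col k → Col k → Set
  Star3 {k} c cu cv =
    Σ (Col k) λ x → Proper x × ¬ (x ≗c c) × KAdj cu x × KAdj cv x ×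
      Σ (Col k) λ cu' → Σ (Col k) λ cv' →
        Triangle x cu cu' × Triangle x cv cv'

  -- Adjacency in the candidate graph G_c (between distinct vertices of G_c).
  GcAdj : {k : ℕ} → Col k → Fin n → Fin n → Set
  GcAdj {k} c u v = (¬ u ≡ v) × CBig c u × CBig c v ×
    Σ (Col k) λ cu → Σ (Col k) λ cv → InC c u cu × InC c v cv × ¬ Star3 c cu cv

  -- G_c ≅ G: there is a map g : V(G) → V(G) that is injective, whose image is
  -- exactly the vertex set of G_c, and that carries adjacency of G to
  -- adjacency of G_c and back.
  GcIsoG : {k : ℕ} → Col k → Set
  GcIsoG c = Σ (Fin n → Fin n) λ g →
      (∀ a b → g a ≡ g b → a ≡ b)
    × (∀ a → CBig c (g a))
    × (∀ u → CBig c u → Σ (Fin n) λ a → g a ≡ u)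
    × (∀ a b → Adj a b ⇔ GcAdj c (g a) (g b))

-- The isomorphism is the identity. Since c misses two colours, every vertex
-- can be recoloured in two ways and so lies in G_c. If u and v are not
-- adjacent, recolouring u as in c_u and v as in c_v gives the common neighbour
-- x, and recolouring a single vertex once more with a missing colour closes
-- both triangles. If u and v are adjacent, let c_u and c_v give u resp. v the
-- same missing colour a. A common Kempe neighbour x ≠ c must put a on u (say),
-- and is then c_v with the colours of u and v exchanged; this Kempe edge
-- between x and c_v swaps an entire two-coloured component, namely the edge
-- uv, and lies in no triangle.

{-# OPTIONS --safe #-}
module Submission where

open import Defs
open import Data.Nat using (ℕ; _+_; _∸_; _<_; _≤_; s≤s)
open import Data.Nat.Properties using (≤-trans; m≤n+m; ∸-monoʳ-≤; m∸[m∸n]≡n; module ≤-Reasoning)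
open import Data.Fin using (Fin; zero; suc)
open import Data.Fin.Properties using (_≟_; suc-injective)
open import Data.Fin.Subset using (Subset; _∈_; ∣_∣; inside; outside; ∁; Nonempty)
open import Data.Fin.Subset.Properties using (∣∁p∣≡n∸∣p∣; x∈∁p⇒x∉p)
open import Data.Vec.Base using (_∷_; here; there)
open import Data.Vec.Functional using (updateAt)
open import Data.Vec.Functional.Properties using (updateAt-updates; updateAt-minimal)
open import Data.Product using (∃; ∃₂; _×_; _,_; proj₁; proj₂)
open import Data.Sum using (_⊎_; inj₁; inj₂)
open import Data.Empty using (⊥)
open import Function using (_∘_; id; const)
open import Function.Bundles using (_⇔_; mk⇔)
open import Relation.Nullary using (¬_; yes; no; contradiction)
open import Relation.Nullary.Decidable using (decidable-stable; _×-dec_; _⊎-dec_)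
open import Relation.Binary.PropositionalEquality using (_≡_; _≢_; refl; sym; trans; subst)

nonempty : ∀ {m} (p : Subset m) → 1 ≤ ∣ p ∣ → Nonempty p
nonempty (inside  ∷ p) _ = zero , here
nonempty (outside ∷ p) h with nonempty p h
... | x , x∈p = suc x , there x∈p

two-members : ∀ {m} (p : Subset m) → 2 ≤ ∣ p ∣ → ∃₂ λ x y → x ≢ y × x ∈ p × y ∈ p
two-members (inside ∷ p) (s≤s h) with nonempty p h
... | y , y∈p = zero , suc y , (λ ()) , here , there y∈p
two-members (outside ∷ p) h with two-members p h
... | x , y , x≢y , x∈p , y∈p = suc x , suc y , x≢y ∘ suc-injective , there x∈p , there y∈p

alternating-in-pair : ∀ {k} {a b c i j : Fin k} →
  (a ≡ i ⊎ a ≡ j) → (b ≡ i ⊎ b ≡ j) → (c ≡ i ⊎ c ≡ j) → b ≢ a → c ≢ b → c ≡ a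
alternating-in-pair (inj₁ refl) (inj₁ refl) _           b≢a _   = contradiction refl b≢a
alternating-in-pair (inj₂ refl) (inj₂ refl) _           b≢a _   = contradiction refl b≢a
alternating-in-pair (inj₁ refl) (inj₂ refl) (inj₁ refl) _   _   = refl
alternating-in-pair (inj₁ refl) (inj₂ refl) (inj₂ refl) _   c≢b = contradiction refl c≢b
alternating-in-pair (inj₂ refl) (inj₁ refl) (inj₁ refl) _   c≢b = contradiction refl c≢b
alternating-in-pair (inj₂ refl) (inj₁ refl) (inj₂ refl) _   _   = refl

module _ (G : Graph) where
  open Graph G using (n; Adj; adj?) renaming (sym to Adj-sym; irrefl to Adj-irrefl)

  Adj⇒≢ : ∀ {u v} → Adj u v → u ≢ v
  Adj⇒≢ uv refl = Adj-irrefl uv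

  Unused : ∀ {k} → Col G k → Fin k → Set
  Unused c f = ∀ w → c w ≢ f

  Moved : ∀ {k} → Col G k → Col G k → Fin n → Set
  Moved d e w = e w ≢ d w

  module _ {k} {i j : Fin k} where
    swapped-pair : ∀ {p p′ q q′} → Swapped G i j p p′ → Swapped G i j q q′ →
                   (q ≡ p × q′ ≡ p′) ⊎ (q ≡ p′ × q′ ≡ p)
    swapped-pair i↦j i↦j = inj₁ (refl , refl)
    swapped-pair i↦j j↦i = inj₂ (refl , refl)
    swapped-pair j↦i i↦j = inj₂ (refl , refl)
    swapped-pair j↦i j↦i = inj₁ (refl , refl)

    swapped-target : ∀ {p q} → Swapped G i j p q → q ≡ i ⊎ q ≡ j
    swapped-target i↦j = inj₂ refl
    swapped-target j↦i = inj₁ refl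

    swapped-≢ : i ≢ j → ∀ {p q} → Swapped G i j p q → q ≢ p
    swapped-≢ i≢j i↦j = i≢j ∘ sym
    swapped-≢ i≢j j↦i = i≢j

  module _ {k} {d : Col G k} {i j : Fin k} where
    linked-source : ∀ {v w} → Linked G d i j v w → InIJ G d i j v
    linked-source (here v∈ij)   = v∈ij
    linked-source (step L _ _) = linked-source L

    linked-target : ∀ {v w} → Linked G d i j v w → InIJ G d i j w
    linked-target (here w∈ij)    = w∈ij
    linked-target (step _ _ w∈ij) = w∈ij

    linked-cons : ∀ {u v w} → Adj u v → InIJ G d i j u → Linked G d i j v w → Linked G d i j u w
    linked-cons uv u∈ij (here v∈ij)      = step (here u∈ij) uv v∈ij
    linked-cons uv u∈ij (step L vw w∈ij) = step (linked-cons uv u∈ij L) vw w∈ij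

    linked-sym : ∀ {v w} → Linked G d i j v w → Linked G d i j w v
    linked-sym (here v∈ij)      = here v∈ij
    linked-sym (step L vw w∈ij) = linked-cons (Adj-sym vw) w∈ij (linked-sym L)

    linked-trans : ∀ {u v w} → Linked G d i j u v → Linked G d i j v w → Linked G d i j u w
    linked-trans L (here _)         = L
    linked-trans L (step M vw w∈ij) = step (linked-trans L M) vw w∈ij

    -- As p is the only vertex of its colour, a path from p alternates between
    -- p and neighbours of p.
    linked-from-unique : Proper G d → ∀ {p} → (∀ t → d t ≡ d p → t ≡ p) →
                         ∀ {t} → Linked G d i j p t → t ≡ p ⊎ Adj p t
    linked-from-unique pd uniq (here _) = inj₁ refl
    linked-from-unique pd uniq (step {w = q} {x = t} L qt t∈ij) with linked-from-unique pd uniq L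
    ... | inj₁ refl = inj₂ qt
    ... | inj₂ pq   = inj₁ (uniq t (alternating-in-pair (linked-source L) (linked-target L) t∈ij
                                      (Adj⇒≢ pq ∘ sym ∘ uniq q) (pd q t qt ∘ sym)))

  module KempeSwap {k} {d e : Col G k} (K : KempeAdj G d e) where
    private
      i j : Fin k
      i = proj₁ K
      j = proj₁ (proj₂ K)

      root : Fin n
      root = proj₁ (proj₂ (proj₂ K))

      i≢j : i ≢ j
      i≢j = proj₁ (proj₂ (proj₂ (proj₂ K)))

      root∈ij : InIJ G d i j root
      root∈ij = proj₁ (proj₂ (proj₂ (proj₂ (proj₂ K))))

      Component : Fin n → Set
      Component = Linked G d i j root

      swapped-on : ∀ {w} → Component w → Swapped G i j (d w) (e w)
      swapped-on {w} = proj₁ (proj₂ (proj₂ (proj₂ (proj₂ (proj₂ K)))) w)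

      fixed-off : ∀ {w} → ¬ Component w → e w ≡ d w
      fixed-off {w} = proj₂ (proj₂ (proj₂ (proj₂ (proj₂ (proj₂ K)))) w)

      -- Linked is not known to be decidable, so a moved vertex lies in the
      -- component only up to double negation; everything concluded from this
      -- is a decidable statement about colours or adjacency, hence stable.
      moved⇒component : ∀ {w} → Moved d e w → ¬ ¬ Component w
      moved⇒component moved = moved ∘ fixed-off

    moved-witness : ∃ (Moved d e)
    moved-witness = root , swapped-≢ i≢j (swapped-on (here root∈ij))

    moved-same-pair : ∀ {p q} → Moved d e p → Moved d e q →
                      (d q ≡ d p × e q ≡ e p) ⊎ (d q ≡ e p × e q ≡ d p)
    moved-same-pair {p} {q} mp mq =
      decidable-stable ((d q ≟ d p ×-dec e q ≟ e p) ⊎-dec (d q ≟ e p ×-dec e q ≟ d p))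
        λ ¬pair → moved⇒component mp λ Cp → moved⇒component mq λ Cq →
          ¬pair (swapped-pair (swapped-on Cp) (swapped-on Cq))

    moved-edge : Proper G d → ∀ {p q} → Adj p q → Moved d e p → Moved d e q →
                 d q ≡ e p × e q ≡ d p
    moved-edge pd pq mp mq with moved-same-pair mp mq
    ... | inj₁ (dq≡dp , _) = contradiction (sym dq≡dp) (pd _ _ pq)
    ... | inj₂ crossed     = crossed

    moved-neighbour : ∀ {p q} → Moved d e p → Adj p q → d q ≡ e p → Moved d e q
    moved-neighbour mp pq dq≡ep = λ eq≡dq → moved⇒component mp λ Cp →
      let q∈ij = subst (λ a → a ≡ i ⊎ a ≡ j) (sym dq≡ep) (swapped-target (swapped-on Cp))
      in swapped-≢ i≢j (swapped-on (step Cp pq q∈ij)) eq≡dq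

    moved-near-unique : Proper G d → ∀ {p q} → (∀ t → d t ≡ d p → t ≡ p) →
                        Moved d e p → Moved d e q → q ≡ p ⊎ Adj p q
    moved-near-unique pd {p} {q} uniq mp mq =
      decidable-stable ((q ≟ p) ⊎-dec adj? p q)
        λ ¬near → moved⇒component mp λ Cp → moved⇒component mq λ Cq →
          ¬near (linked-from-unique pd uniq (linked-trans (linked-sym Cp) Cq))

  recolour : ∀ {k} → Col G k → Fin n → Fin k → Col G k
  recolour d w f = updateAt d w (const f)

  module _ {k} (d : Col G k) (w : Fin n) (f : Fin k) where
    recolour-at : recolour d w f w ≡ f
    recolour-at = updateAt-updates w d

    recolour-off : ∀ t → t ≢ w → recolour d w f t ≡ d t
    recolour-off t t≢w = updateAt-minimal t w d t≢w

  recolour-proper : ∀ {k} {d : Col G k} {w f} → Proper G d → (∀ t → Adj w t → d t ≢ f) →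
                    Proper G (recolour d w f)
  recolour-proper {d = d} {w} {f} pd avoids p q pq eq with p ≟ w | q ≟ w
  ... | yes refl | yes refl = Adj-irrefl pq
  ... | yes refl | no q≢w  =
    avoids q pq (trans (sym (recolour-off d w f q q≢w)) (trans (sym eq) (recolour-at d w f)))
  ... | no p≢w   | yes refl =
    avoids p (Adj-sym pq) (trans (sym (recolour-off d w f p p≢w)) (trans eq (recolour-at d w f)))
  ... | no p≢w   | no q≢w  =
    pd p q pq (trans (sym (recolour-off d w f p p≢w)) (trans eq (recolour-off d w f q q≢w)))

  recolour-InC : ∀ {k} {c : Col G k} {f} → Proper G c → Unused c f →
                 ∀ w → InC G c w (recolour c w f)
  recolour-InC {c = c} {f} pc f-unused w =
    recolour-proper pc (λ t _ → f-unused t) ,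
    f-unused w ∘ sym ∘ trans (sym (recolour-at c w f)) ,
    recolour-off c w f

  -- Swapping {d w, e w} on the component of w recolours w alone.
  kempe-at-vertex : ∀ {k} {d e : Col G k} {w} → Proper G d → Proper G e → e w ≢ d w →
                    (∀ t → t ≢ w → e t ≡ d t) → KAdj G d e
  kempe-at-vertex {d = d} {e} {w} pd pe ew≢dw agree =
    pd , pe , d w , e w , w , ew≢dw ∘ sym , inj₁ refl , λ t → swapped t , fixed t
    where
    only-w : ∀ {t} → Linked G d (d w) (e w) w t → t ≡ w
    only-w (here _) = refl
    only-w (step {x = t} L wt t∈ij) with only-w L
    ... | refl with t∈ij
    ...   | inj₁ dt≡dw = contradiction (sym dt≡dw) (pd w t wt)
    ...   | inj₂ dt≡ew = contradiction (sym (trans (agree t (Adj⇒≢ wt ∘ sym)) dt≡ew)) (pe w t wt)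

    swapped : ∀ t → Linked G d (d w) (e w) w t → Swapped G (d w) (e w) (d t) (e t)
    swapped t L with only-w L
    ... | refl = i↦j

    fixed : ∀ t → ¬ Linked G d (d w) (e w) w t → e t ≡ d t
    fixed t ¬L with t ≟ w
    ... | yes refl = contradiction (here (inj₁ refl)) ¬L
    ... | no t≢w   = agree t t≢w

  recolour-triangle : ∀ {k} {x y : Col G k} {w f} → Proper G x → Proper G y → y w ≢ x w →
                      (∀ t → t ≢ w → y t ≡ x t) → f ≢ x w → f ≢ y w →
                      (∀ t → Adj w t → y t ≢ f) → Triangle G x y (recolour y w f)
  recolour-triangle {y = y} {w} {f} px py yw≢xw agree f≢xw f≢yw avoids =
    kempe-at-vertex px py yw≢xw agree ,
    kempe-at-vertex py py′ (f≢yw ∘ trans (sym (recolour-at y w f))) (recolour-off y w f) ,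
    kempe-at-vertex px py′ (f≢xw ∘ trans (sym (recolour-at y w f)))
      (λ t t≢w → trans (recolour-off y w f t t≢w) (agree t t≢w))
    where
    py′ : Proper G (recolour y w f)
    py′ = recolour-proper py avoids

  -- Non-adjacent vertices satisfy (★★★)

  module _ {k} {c : Col G k} (pc : Proper G c)
           (fresh : ∀ b → ∃ λ f → f ≢ b × Unused c f) where

    kempe-and-triangle : ∀ {p q cp x} → q ≢ p → ¬ Adj p q → InC G c p cp → Proper G x →
                         x q ≢ cp q → (∀ t → t ≢ q → x t ≡ cp t) →
                         KAdj G cp x × ∃ λ cp′ → Triangle G x cp cp′
    kempe-and-triangle {q = q} {cp} {x} q≢p ¬pq (pcp , _ , cp-off) px xq≢cpq agree =
      kempe-at-vertex pcp px xq≢cpq agree ,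
      recolour cp q f ,
      recolour-triangle px pcp (xq≢cpq ∘ sym) (λ t t≢q → sym (agree t t≢q)) f≢xq
        (f-unused q ∘ trans (sym (cp-off q q≢p)) ∘ sym)
        (λ t qt → f-unused t ∘ trans (sym (cp-off t λ { refl → ¬pq (Adj-sym qt) })))
      where
      f : Fin k
      f = proj₁ (fresh (x q))

      f≢xq : f ≢ x q
      f≢xq = proj₁ (proj₂ (fresh (x q)))

      f-unused : Unused c f
      f-unused = proj₂ (proj₂ (fresh (x q)))

    nonadjacent⇒star : ∀ {u v cu cv} → u ≢ v → ¬ Adj u v → InC G c u cu → InC G c v cv →
                       Star3 G c cu cv
    nonadjacent⇒star {u} {v} {cu} {cv} u≢v ¬uv
                     icu@(pcu , cuu≢cu , cu-off) icv@(pcv , cvv≢cv , cv-off) =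
      x , px , x≉c , proj₁ at-u , proj₁ at-v , proj₁ (proj₂ at-u) , proj₁ (proj₂ at-v) ,
      proj₂ (proj₂ at-u) , proj₂ (proj₂ at-v)
      where
      x : Col G k
      x = recolour cu v (cv v)

      x-off-v : ∀ t → t ≢ v → x t ≡ cu t
      x-off-v = recolour-off cu v (cv v)

      x-off-u : ∀ t → t ≢ u → x t ≡ cv t
      x-off-u t t≢u with t ≟ v
      ... | yes refl = recolour-at cu v (cv v)
      ... | no t≢v   = trans (x-off-v t t≢v) (trans (cu-off t t≢u) (sym (cv-off t t≢v)))

      px : Proper G x
      px = recolour-proper pcu λ t vt cut≡cvv →
        pcv v t vt (sym (trans (sym (x-off-u t λ { refl → ¬uv (Adj-sym vt) }))
                               (trans (x-off-v t (Adj⇒≢ vt ∘ sym)) cut≡cvv)))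

      x≉c : ¬ (_≗c_ G x c)
      x≉c x≗c = cuu≢cu (trans (sym (x-off-v u u≢v)) (x≗c u))

      at-u : KAdj G cu x × ∃ λ cu′ → Triangle G x cu cu′
      at-u = kempe-and-triangle (u≢v ∘ sym) ¬uv icu px
               (λ eq → cvv≢cv (trans (sym (recolour-at cu v (cv v))) (trans eq (cu-off v (u≢v ∘ sym)))))
               x-off-v

      at-v : KAdj G cv x × ∃ λ cv′ → Triangle G x cv cv′
      at-v = kempe-and-triangle u≢v (¬uv ∘ Adj-sym) icv px
               (λ eq → cuu≢cu (trans (sym (x-off-v u u≢v)) (trans eq (cv-off u u≢v)))) x-off-u

  -- Adjacent vertices violate (★★★)

  -- y arises from x by swapping the two colours of the edge uv, which forms a
  -- whole two-coloured component, and the colour x u occurs only at u.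
  record EdgeExchange {k} (x y : Col G k) (u v : Fin n) : Set where
    field
      proper-x : Proper G x
      proper-y : Proper G y
      edge     : Adj u v
      cross-u  : x u ≡ y v
      cross-v  : x v ≡ y u
      agree    : ∀ t → t ≢ u → t ≢ v → x t ≡ y t
      unique-u : ∀ t → x t ≡ x u → t ≡ u

  module _ {k} {x y : Col G k} {u v} (E : EdgeExchange x y u v) where
    open EdgeExchange E

    cross-≢ : x u ≢ y u
    cross-≢ xu≡yu = proper-x u v edge (trans xu≡yu (sym cross-v))

    unique-v : ∀ t → y t ≡ y v → t ≡ v
    unique-v t yt≡yv with t ≟ v | t ≟ u
    ... | yes t≡v | _        = t≡v
    ... | no _    | yes refl = contradiction yt≡yv (proper-y t v edge)
    ... | no t≢v  | no t≢u   =
      contradiction (unique-u t (trans (agree t t≢u t≢v) (trans yt≡yv (sym cross-u)))) t≢u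

    lone-u : ∀ t → Adj u t → x t ≡ x v → t ≡ v
    lone-u t ut xt≡xv = decidable-stable (t ≟ v) λ t≢v →
      proper-y u t ut (sym (trans (sym (agree t (Adj⇒≢ ut ∘ sym) t≢v)) (trans xt≡xv cross-v)))

    exchange-sym : EdgeExchange y x v u
    exchange-sym = record
      { proper-x = proper-y
      ; proper-y = proper-x
      ; edge     = Adj-sym edge
      ; cross-u  = sym cross-u
      ; cross-v  = sym cross-v
      ; agree    = λ t t≢v t≢u → sym (agree t t≢u t≢v)
      ; unique-u = unique-v
      }

  module _ {k} {x y z : Col G k} {u v} (E : EdgeExchange x y u v)
           (X : KempeAdj G x z) (Y : KempeAdj G y z) where
    open EdgeExchange E
    private
      module X = KempeSwap X
      module Y = KempeSwap Y

      u-moved : z u ≡ y u → Moved x z u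
      u-moved zu≡yu zu≡xu = cross-≢ E (trans (sym zu≡xu) zu≡yu)

    fixing-u-fixes-v : z u ≡ y u → z v ≡ y v
    fixing-u-fixes-v zu≡yu = trans (proj₂ (X.moved-edge proper-x edge (u-moved zu≡yu) v-moved)) cross-u
      where
      v-moved : Moved x z v
      v-moved = X.moved-neighbour (u-moved zu≡yu) edge (trans cross-v (sym zu≡yu))

    -- A vertex moved together with u lies next to u and has colour x v.
    fixing-u-fixes-off-edge : z u ≡ y u → ∀ r → r ≢ u → r ≢ v → Moved x z r → ⊥
    fixing-u-fixes-off-edge zu≡yu r r≢u r≢v r-moved
      with X.moved-near-unique proper-x unique-u (u-moved zu≡yu) r-moved
         | X.moved-same-pair (u-moved zu≡yu) r-moved
    ... | inj₁ r≡u | _                = r≢u r≡u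
    ... | inj₂ _   | inj₁ (xr≡xu , _) = r≢u (unique-u r xr≡xu)
    ... | inj₂ ur  | inj₂ (xr≡zu , _) = r≢v (lone-u E r ur (trans xr≡zu (trans zu≡yu (sym cross-v))))

    exchange-fixing-u : z u ≡ y u → ⊥
    exchange-fixing-u zu≡yu with Y.moved-witness
    ... | r , r-movedʸ = fixing-u-fixes-off-edge zu≡yu r r≢u r≢v
                           (λ zr≡xr → r-movedʸ (trans zr≡xr (agree r r≢u r≢v)))
      where
      r≢u : r ≢ u
      r≢u refl = r-movedʸ zu≡yu

      r≢v : r ≢ v
      r≢v refl = r-movedʸ (fixing-u-fixes-v zu≡yu)

    exchange-moving-u : Moved x z u → ⊥
    exchange-moving-u u-movedˣ with z u ≟ y u
    ... | yes zu≡yu   = exchange-fixing-u zu≡yu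
    ... | no u-movedʸ =
      u-movedʸ (trans (sym (proj₁ (X.moved-edge proper-x edge u-movedˣ v-movedˣ))) cross-v)
      where
      v-movedˣ : Moved x z v
      v-movedˣ zv≡xv =
        u-movedˣ (trans (sym (proj₁ (Y.moved-edge proper-y edge u-movedʸ v-movedʸ))) (sym cross-u))
        where
        v-movedʸ : Moved y z v
        v-movedʸ zv≡yv = proper-y u v edge (trans (sym cross-v) (trans (sym zv≡xv) zv≡yv))

  exchange-no-common-neighbour : ∀ {k} {x y z : Col G k} {u v} → EdgeExchange x y u v →
                                 KempeAdj G x z → KempeAdj G y z → ⊥
  exchange-no-common-neighbour {x = x} {y} {z} {u} E X Y with z u ≟ x u
  ... | no u-movedˣ = exchange-moving-u E X Y u-movedˣ
  ... | yes zu≡xu   = exchange-moving-u (exchange-sym E) Y X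
                        (KempeSwap.moved-neighbour Y u-movedʸ edge (trans (sym cross-u) (sym zu≡xu)))
    where
    open EdgeExchange E
    u-movedʸ : Moved y z u
    u-movedʸ zu≡yu = cross-≢ E (trans (sym zu≡xu) zu≡yu)

  module _ {k} {c : Col G k} (pc : Proper G c) {a : Fin k} (a-unused : Unused c a) where
    cₐ : Fin n → Col G k
    cₐ w = recolour c w a

    cₐ-proper : ∀ w → Proper G (cₐ w)
    cₐ-proper w = proj₁ (recolour-InC pc a-unused w)

    cₐ-at : ∀ w → cₐ w w ≡ a
    cₐ-at w = recolour-at c w a

    cₐ-off : ∀ w t → t ≢ w → cₐ w t ≡ c t
    cₐ-off w = recolour-off c w a

    moved-off-painted : ∀ {p x w} → KempeAdj G (cₐ p) x → x p ≡ c p → w ≢ p → x w ≢ c w →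
                        c w ≡ c p
    moved-off-painted {p} {x} {w} K xp≡cp w≢p xw≢cw with KempeSwap.moved-same-pair K p-moved w-moved
      where
      p-moved : Moved (cₐ p) x p
      p-moved xp≡a = a-unused p (trans (sym xp≡cp) (trans xp≡a (cₐ-at p)))

      w-moved : Moved (cₐ p) x w
      w-moved xw≡cₐw = xw≢cw (trans xw≡cₐw (cₐ-off p w w≢p))
    ... | inj₁ (cₐw≡a , _)  =
      contradiction (trans (sym (cₐ-off p w w≢p)) (trans cₐw≡a (cₐ-at p))) (a-unused w)
    ... | inj₂ (cₐw≡xp , _) = trans (sym (cₐ-off p w w≢p)) (trans cₐw≡xp xp≡cp)

    module _ {u v x} (uv : Adj u v) (K₁ : KempeAdj G (cₐ u) x) (K₂ : KempeAdj G (cₐ v) x) where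
      private
        module K₁ = KempeSwap K₁
        module K₂ = KempeSwap K₂

        u≢v : u ≢ v
        u≢v = Adj⇒≢ uv

        v≢u : v ≢ u
        v≢u = u≢v ∘ sym

      keeps-colour : x v ≢ a → x u ≢ a → x u ≡ c u
      keeps-colour xv≢a xu≢a = decidable-stable (x u ≟ c u) (xu≢a ∘ moved⇒a)
        where
        v-moved : Moved (cₐ v) x v
        v-moved xv≡a = xv≢a (trans xv≡a (cₐ-at v))

        moved⇒a : x u ≢ c u → x u ≡ a
        moved⇒a xu≢cu = trans (proj₂ (K₂.moved-edge (cₐ-proper v) (Adj-sym uv) v-moved
                                        (xu≢cu ∘ λ xu≡cₐu → trans xu≡cₐu (cₐ-off v u u≢v))))
                              (cₐ-at v)

      equals-c : x u ≡ c u → x v ≡ c v → _≗c_ G x c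
      equals-c xu≡cu xv≡cv w with w ≟ u | w ≟ v
      ... | yes refl | _        = xu≡cu
      ... | no _     | yes refl = xv≡cv
      ... | no w≢u   | no w≢v   = decidable-stable (x w ≟ c w) λ xw≢cw →
        pc u v uv (trans (sym (moved-off-painted K₁ xu≡cu w≢u xw≢cw))
                         (moved-off-painted K₂ xv≡cv w≢v xw≢cw))

      module _ (xu≡a : x u ≡ a) where
        private
          u-moved₂ : Moved (cₐ v) x u
          u-moved₂ xu≡cₐu = a-unused u (trans (sym (trans xu≡cₐu (cₐ-off v u u≢v))) xu≡a)

        painted-neighbour : x v ≡ c u
        painted-neighbour =
          trans (proj₂ (K₂.moved-edge (cₐ-proper v) uv u-moved₂ v-moved₂)) (cₐ-off v u u≢v)
          where
          v-moved₂ : Moved (cₐ v) x v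
          v-moved₂ = K₂.moved-neighbour u-moved₂ uv (trans (cₐ-at v) (sym xu≡a))

        -- A vertex off the edge moving in both swaps would take colour a in
        -- the first and a colour of {c u, c v} in the second.
        painted-off-edge : ∀ t → t ≢ u → t ≢ v → x t ≡ c t
        painted-off-edge t t≢u t≢v = decidable-stable (x t ≟ c t) λ xt≢ct →
          not-a (xt≢ct ∘ λ xt≡cₐt → trans xt≡cₐt (cₐ-off u t t≢u))
                (to-a (xt≢ct ∘ λ xt≡cₐt → trans xt≡cₐt (cₐ-off v t t≢v)))
          where
          to-a : Moved (cₐ v) x t → x t ≡ a
          to-a t-moved with K₂.moved-same-pair u-moved₂ t-moved
          ... | inj₁ (_ , xt≡xu)   = trans xt≡xu xu≡a
          ... | inj₂ (cₐt≡xu , _) =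
            contradiction (trans (sym (cₐ-off v t t≢v)) (trans cₐt≡xu xu≡a)) (a-unused t)

          v-moved₁ : Moved (cₐ u) x v
          v-moved₁ xv≡cₐv =
            pc u v uv (trans (sym painted-neighbour) (trans xv≡cₐv (cₐ-off u v v≢u)))

          not-a : Moved (cₐ u) x t → x t ≢ a
          not-a t-moved xt≡a with K₁.moved-same-pair v-moved₁ t-moved
          ... | inj₁ (_ , xt≡xv)   =
            a-unused u (trans (sym painted-neighbour) (trans (sym xt≡xv) xt≡a))
          ... | inj₂ (_ , xt≡cₐv) =
            a-unused v (trans (sym (cₐ-off u v v≢u)) (trans (sym xt≡cₐv) xt≡a))

        painted-unique : ∀ t → x t ≡ x u → t ≡ u
        painted-unique t xt≡xu with t ≟ u | t ≟ v
        ... | yes t≡u | _        = t≡u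
        ... | no _    | yes refl =
          contradiction (trans (sym painted-neighbour) (trans xt≡xu xu≡a)) (a-unused u)
        ... | no t≢u  | no t≢v   =
          contradiction (trans (sym (painted-off-edge t t≢u t≢v)) (trans xt≡xu xu≡a)) (a-unused t)

        painted-exchange : Proper G x → EdgeExchange x (cₐ v) u v
        painted-exchange px = record
          { proper-x = px
          ; proper-y = cₐ-proper v
          ; edge     = uv
          ; cross-u  = trans xu≡a (sym (cₐ-at v))
          ; cross-v  = trans painted-neighbour (sym (cₐ-off v u u≢v))
          ; agree    = λ t t≢u t≢v → trans (painted-off-edge t t≢u t≢v) (sym (cₐ-off v t t≢v))
          ; unique-u = painted-unique
          }

    adjacent⇒¬star : ∀ {u v} → Adj u v → ¬ Star3 G c (cₐ u) (cₐ v)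
    adjacent⇒¬star {u} {v} uv (x , px , x≉c , (_ , _ , K₁) , (_ , _ , K₂) , _ , _ ,
                                (_ , (_ , _ , Ku) , (_ , _ , Kxu)) , (_ , (_ , _ , Kv) , (_ , _ , Kxv)))
      with x u ≟ a | x v ≟ a
    ... | yes xu≡a | _        =
      exchange-no-common-neighbour (painted-exchange uv K₁ K₂ xu≡a px) Kxv Kv
    ... | no _     | yes xv≡a =
      exchange-no-common-neighbour (painted-exchange (Adj-sym uv) K₂ K₁ xv≡a px) Kxu Ku
    ... | no xu≢a  | no xv≢a  =
      x≉c (equals-c uv K₁ K₂ (keeps-colour uv K₁ K₂ xv≢a xu≢a)
                             (keeps-colour (Adj-sym uv) K₂ K₁ xu≢a xv≢a))

  module _ {k} {c : Col G k} (pc : Proper G c) {e₁ e₂ : Fin k} (e₁≢e₂ : e₁ ≢ e₂)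
           (e₁-unused : Unused c e₁) (e₂-unused : Unused c e₂) where

    every-CBig : ∀ w → CBig G c w
    every-CBig w =
      recolour c w e₁ , recolour c w e₂ ,
      recolour-InC pc e₁-unused w , recolour-InC pc e₂-unused w ,
      λ same → e₁≢e₂ (trans (sym (recolour-at c w e₁)) (trans (same w) (recolour-at c w e₂)))

    fresh : ∀ b → ∃ λ f → f ≢ b × Unused c f
    fresh b with e₁ ≟ b
    ... | yes refl = e₂ , e₁≢e₂ ∘ sym , e₂-unused
    ... | no e₁≢b  = e₁ , e₁≢b , e₁-unused

    Adj⇔GcAdj : ∀ u v → Adj u v ⇔ GcAdj G c u v
    Adj⇔GcAdj u v = mk⇔
      (λ uv → Adj⇒≢ uv , every-CBig u , every-CBig v , cₐ pc e₁-unused u , cₐ pc e₁-unused v ,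
              recolour-InC pc e₁-unused u , recolour-InC pc e₁-unused v ,
              adjacent⇒¬star pc e₁-unused uv)
      (λ { (u≢v , _ , _ , _ , _ , icu , icv , ¬star) → decidable-stable (adj? u v) λ ¬uv →
             ¬star (nonadjacent⇒star pc fresh u≢v ¬uv icu icv) })

    Gc≅G : GcIsoG G c
    Gc≅G = id , (λ _ _ → id) , every-CBig , (λ u _ → u , refl) , Adj⇔GcAdj

two-unused-colours : ∀ (G : Graph) {k} {c : Col G k} → 2 ≤ k → UsesAtMost G c (k ∸ 2) →
                     ∃₂ λ e₁ e₂ → e₁ ≢ e₂ × Unused G c e₁ × Unused G c e₂
two-unused-colours G {k} {c} 2≤k (S , ∣S∣≤k∸2 , c∈S) with two-members (∁ S) 2≤∣∁S∣
  where
  open ≤-Reasoning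
  2≤∣∁S∣ : 2 ≤ ∣ ∁ S ∣
  2≤∣∁S∣ = begin
    2                ≡⟨ m∸[m∸n]≡n 2≤k ⟨
    k ∸ (k ∸ 2)      ≤⟨ ∸-monoʳ-≤ k ∣S∣≤k∸2 ⟩
    k ∸ ∣ S ∣        ≡⟨ ∣∁p∣≡n∸∣p∣ S ⟨
    ∣ ∁ S ∣          ∎
... | e₁ , e₂ , e₁≢e₂ , e₁∈∁S , e₂∈∁S =
  e₁ , e₂ , e₁≢e₂ , unused e₁∈∁S , unused e₂∈∁S
  where
  unused : ∀ {e} → e ∈ ∁ S → Unused G c e
  unused e∈∁S w cw≡e = x∈∁p⇒x∉p e∈∁S (subst (_∈ S) cw≡e (c∈S w))

lemma3p6 : (G : Graph) (k χ : ℕ) → IsChromaticNumber G χ → χ + 1 < k →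
    (c : Col G k) → Proper G c → UsesAtMost G c (k ∸ 2) → GcIsoG G c
lemma3p6 G k χ _ χ+1<k c pc uses with two-unused-colours G (≤-trans (s≤s (m≤n+m 1 χ)) χ+1<k) uses
... | e₁ , e₂ , e₁≢e₂ , e₁-unused , e₂-unused = Gc≅G G pc e₁≢e₂ e₁-unused e₂-unused
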